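{- Let $S$ be a set and $\to\subseteq S\times S$ a binary relation. For all $P,Q\subseteq S\times S$, $F\subseteq (S\times S)\times(S\times S)$ and $c_0,c_1:S\to\mathbb{N}$, $\mathrm{Ensures2}_{\to}(P,Q,F,c_0,c_1)\iff \mathrm{Ensures2}_{\to}(P^S,Q^S,F^S,c_1,c_0)$, where $P^S=\{(s_1,s_0)\mid (s_0,s_1)\in P\}$, $Q^S=\{(s_1,s_0)\mid (s_0,s_1)\in Q\}$ and $F^S=\{((s_1,s_0),(s_1',s_0'))\mid ((s_0,s_1),(s_0',s_1'))\in F\}$.
   Context: For $n\in\mathbb{N}$, $\to^n$ denotes the $n$-fold composition of $\to$, with $\to^0$ the identity relation on $S$. For $n\in\mathbb{N}$ and $Q\subseteq S$, $\mathrm{EvN}_{\to}(n,Q)=\{s\in S\mid (\forall s'.\ s\to^n s'\Rightarrow s'\in Q)\wedge(\forall s'\,\forall l<n.\ s\to^l s'\Rightarrow\exists s''.\ s'\to s'')\}$. For $P,Q\subseteq S\times S$, $F\subseteq(S\times S)\times(S\times S)$ and $c_0,c_1:S\to\mathbb{N}$, $\mathrm{Ensures2}_{\to}(P,Q,F,c_0,c_1)$ means: for all $(s_0,s_1)\in P$, $s_0\in\mathrm{EvN}_{\to}\big(c_0(s_0),\{s_0'\mid s_1\in\mathrm{EvN}_{\to}(c_1(s_1),\{s_1'\mid (s_0',s_1')\in Q\wedge((s_0,s_1),(s_0',s_1'))\in F\})\}\big)$. -}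

module Defs where

open import Data.Nat using (ℕ; zero; suc; _<_)
open import Data.Product using (_×_; _,_; ∃)
open import Function.Bundles using (_⇔_)

Rel₂ : Set → Set₁
Rel₂ S = S → S → Set

Pred : Set → Set₁
Pred A = A → Set

data Iter {S : Set} (_⟶_ : Rel₂ S) : ℕ → S → S → Set where
  iter-zero : ∀ {s} → Iter _⟶_ zero s s
  iter-suc  : ∀ {n s s' s''} → s ⟶ s' → Iter _⟶_ n s' s'' → Iter _⟶_ (suc n) s s''

EvN : {S : Set} → Rel₂ S → ℕ → Pred S → Pred S
EvN {S} _⟶_ n Q s =
  (∀ (s' : S) → Iter _⟶_ n s s' → Q s') ×
  (∀ (s' : S) (l : ℕ) → l < n → Iter _⟶_ l s s' → ∃ λ (s'' : S) → s' ⟶ s'')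

Ensures2 : {S : Set} → Rel₂ S → Pred (S × S) → Pred (S × S) →
           Pred ((S × S) × (S × S)) → (S → ℕ) → (S → ℕ) → Set
Ensures2 {S} _⟶_ P Q F c₀ c₁ =
  ∀ (s₀ s₁ : S) → P (s₀ , s₁) →
  EvN _⟶_ (c₀ s₀)
    (λ s₀' → EvN _⟶_ (c₁ s₁)
       (λ s₁' → Q (s₀' , s₁') × F ((s₀ , s₁) , (s₀' , s₁')))
       s₁)
    s₀

swapP : {S : Set} → Pred (S × S) → Pred (S × S)
swapP P (s₁ , s₀) = P (s₀ , s₁)

swapF : {S : Set} → Pred ((S × S) × (S × S)) → Pred ((S × S) × (S × S))
swapF F ((s₁ , s₀) , (s₁' , s₀')) = F ((s₀ , s₁) , (s₀' , s₁'))

{-# OPTIONS --safe #-}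
module Submission where

-- Nesting EvN asserts the
-- liveness of the inner run once per endpoint of the outer run, so swapping the
-- nesting only needs the outer run to have some endpoint, which its own liveness
-- provides.

open import Defs
open import Data.Nat using (ℕ; zero; suc; _<_; z<s; s<s)
open import Data.Product using (_×_; _,_; ∃; proj₁; proj₂)
open import Function.Base using (flip)
open import Function.Bundles using (_⇔_; mk⇔)

module _ {S : Set} {_⟶_ : Rel₂ S} where

  NonBlocking : ℕ → Pred S
  NonBlocking n s = ∀ s' l → l < n → Iter _⟶_ l s s' → ∃ (s' ⟶_)

  nonBlocking⇒iter : ∀ n {s} → NonBlocking n s → ∃ (Iter _⟶_ n s)
  nonBlocking⇒iter zero    live = _ , iter-zero
  nonBlocking⇒iter (suc n) {s} live =
    let s₁ , step = live s zero z<s iter-zero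
        s' , run  = nonBlocking⇒iter n λ t l l<n run → live t (suc l) (s<s l<n) (iter-suc step run)
    in  s' , iter-suc step run

  EvN-satisfiable : ∀ n {Q s} → EvN _⟶_ n Q s → ∃ Q
  EvN-satisfiable n (post , live) =
    let s' , run = nonBlocking⇒iter n live in s' , post s' run

  EvN-comm : ∀ n m {s₀ s₁} (R : S → S → Set) →
             EvN _⟶_ n (λ a → EvN _⟶_ m (R a) s₁) s₀ →
             EvN _⟶_ m (λ b → EvN _⟶_ n (flip R b) s₀) s₁
  EvN-comm n m R (post , live) =
    (λ b runb → (λ a runa → proj₁ (post a runa) b runb) , live) ,
    proj₂ (proj₂ (EvN-satisfiable n (post , live)))

  Ensures2-swap : ∀ {P Q F c₀ c₁} → Ensures2 _⟶_ P Q F c₀ c₁ →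
                  Ensures2 _⟶_ (swapP P) (swapP Q) (swapF F) c₁ c₀
  Ensures2-swap {c₀ = c₀} {c₁} ens s₁ s₀ p = EvN-comm (c₀ s₀) (c₁ s₁) _ (ens s₀ s₁ p)

lemma2 : (S : Set) (_⟶_ : Rel₂ S) (P Q : Pred (S × S)) (F : Pred ((S × S) × (S × S)))
         (c₀ c₁ : S → ℕ) →
         Ensures2 _⟶_ P Q F c₀ c₁ ⇔ Ensures2 _⟶_ (swapP P) (swapP Q) (swapF F) c₁ c₀
-- swapP and swapF are involutions up to definitional equality, so the converse
-- is the same lemma.
lemma2 S _⟶_ P Q F c₀ c₁ = mk⇔ Ensures2-swap Ensures2-swap
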